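{- Let $G=(V,E)$ be a connected graph, $c:V\to\mathbb{N}$, and $0<\epsilon<1$. The Iterative Rounding algorithm (run SolveIP2$(G,\emptyset,c)$) approximates PDBEP with approximation factor $3/(1-\epsilon)^2$: its output $E'$ is a feasible PDBEP solution and $\mathrm{OPT}\le \frac{3}{(1-\epsilon)^2}|E'|$, where $\mathrm{OPT}$ is the maximum cardinality of a feasible PDBEP solution.
   Context: PDBEP: given $G=(V,E)$ and $c:V\to\mathbb{N}$, $E'\subseteq E$ is feasible if for every $(u,v)\in E'$, $d'_u\le c_u$ or $d'_v\le c_v$, with $d'_x$ the degree of $x$ in $(V,E')$. For a graph $H=(V_H,E_H)$, $f:V_H\to\{0,1,2,\dots\}$ and $C\subseteq V_H$, LP2$(H,f,C)$ is: maximize $2\sum_{e\in E_H}y_e-(1+\epsilon)\sum_{v\in V_H}z_v$ subject to $\sum_{e\in\delta(v)}y_e\le f_v+z_v$ for $v\in V_H\setminus C$; $\sum_{e\in\delta(v)}y_e\le f_v$ for $v\in C$; $z_v\ge0$; $0\le y_e\le1$ ($\delta(v)$ = edges of $H$ incident on $v$). The recursive procedure SolveIP2$(H,C,f)$: if $E_H=\emptyset$ return $\emptyset$. Delete all isolated vertices. Compute an optimal extreme point solution $(y,z)$ of LP2$(H,f,C)$. If some $e\in E_H$ has $y_e=0$, return SolveIP2$((V_H,E_H\setminus\{e\}),C,f)$. Otherwise choose an edge $e=(u,v)$ with $y_e\ge 1/2$ and name its endpoints so that $f_v>0$ and $z_v=0$ (such a choice always exists); set $f_v:=f_v-1$, $f_u:=\max\{f_u-1,0\}$,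 $C:=C\cup\{v\}$, and return SolveIP2$((V_H,E_H\setminus\{e\}),C,f)\cup\{e\}$.
   Formalization: The parameter ε ranges over the rationals with $0<\epsilon<1$, and the points (y,z) of LP2 take rational values. -}

module Defs where

open import Data.Nat using (ℕ; zero; suc; _∸_) renaming (_≤_ to _≤ℕ_; _<_ to _<ℕ_)
open import Data.Integer using (+_)
open import Data.Rational using (ℚ; 0ℚ; 1ℚ; _+_; _*_; _-_; _≤_; _<_) renaming (_/_ to _//_)
open import Data.Fin using (Fin; zero; suc; _≟_)
open import Data.Fin.Subset using (Subset; _∈_; _∉_; _∪_; _─_; ⁅_⁆)
open import Data.Vec using (lookup)
open import Data.Bool using (Bool; true; false; if_then_else_; _∧_; _∨_)
open import Data.Product using (_×_; _,_; proj₁; proj₂; swap)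
open import Data.Sum using (_⊎_)
open import Relation.Nullary using (¬_)
open import Relation.Nullary.Decidable using (⌊_⌋)
open import Relation.Binary.PropositionalEquality using (_≡_; _≢_)

toℚ : ℕ → ℚ
toℚ k = (+ k) // 1

∑ : ∀ {k} → (Fin k → ℚ) → ℚ
∑ {zero}  g = 0ℚ
∑ {suc k} g = g zero + ∑ (λ i → g (suc i))

count : ∀ {k} → (Fin k → Bool) → ℕ
count {zero}  b = 0
count {suc k} b = (if b zero then 1 else 0) Data.Nat.+ count (λ i → b (suc i))

anyFin : ∀ {k} → (Fin k → Bool) → Bool
anyFin {zero}  b = false
anyFin {suc k} b = b zero ∨ anyFin (λ i → b (suc i))

record Graph (n m : ℕ) : Set where
  field
    ends     : Fin m → Fin n × Fin n
    loopless : ∀ i → proj₁ (ends i) ≢ proj₂ (ends i)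
    simple   : ∀ i j → (ends i ≡ ends j ⊎ ends i ≡ swap (ends j)) → i ≡ j

module _ {n m : ℕ} (G : Graph n m) where
  open Graph G

  inc : Fin n → Fin m → Bool
  inc x i = ⌊ x ≟ proj₁ (ends i) ⌋ ∨ ⌊ x ≟ proj₂ (ends i) ⌋

  data Reach : Fin n → Fin n → Set where
    here : ∀ {x} → Reach x x
    step : ∀ {x y} i → ends i ≡ (x , y) ⊎ ends i ≡ (y , x) → ∀ {w} → Reach y w → Reach x w

  Connected : Set
  Connected = ∀ x w → Reach x w

  deg : Subset m → Fin n → ℕ
  deg F x = count (λ i → lookup F i ∧ inc x i)

  Feasible : (Fin n → ℕ) → Subset m → Set
  Feasible c F = ∀ i → i ∈ F →
    (deg F (proj₁ (ends i)) ≤ℕ c (proj₁ (ends i))) ⊎ (deg F (proj₂ (ends i)) ≤ℕ c (proj₂ (ends i)))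

  dropIsolated : Subset n → Subset m → Subset n
  dropIsolated VH EH = Data.Vec.tabulate (λ v → lookup VH v ∧ anyFin (λ i → lookup EH i ∧ inc v i))

  decr : Fin n → Fin n → (Fin n → ℕ) → (Fin n → ℕ)
  decr u v f w = if ⌊ w ≟ u ⌋ ∨ ⌊ w ≟ v ⌋ then f w ∸ 1 else f w

  -- Variables: y : Fin m → ℚ (one per edge of H), z : Fin n → ℚ (one per vertex of H);
  -- coordinates outside H are fixed to 0 (they are not variables of the LP).
  module LP2 (ε : ℚ) (VH : Subset n) (EH : Subset m) (C : Subset n) (f : Fin n → ℕ) where

    loadY : (Fin m → ℚ) → Fin n → ℚ
    loadY y v = ∑ (λ i → if lookup EH i ∧ inc v i then y i else 0ℚ)

    objective : (Fin m → ℚ) → (Fin n → ℚ) → ℚ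
    objective y z = (toℚ 2 * ∑ (λ i → if lookup EH i then y i else 0ℚ))
                    - ((1ℚ + ε) * ∑ (λ v → if lookup VH v then z v else 0ℚ))

    record Feas (y : Fin m → ℚ) (z : Fin n → ℚ) : Set where
      field
        y-out  : ∀ i → i ∉ EH → y i ≡ 0ℚ
        z-out  : ∀ v → v ∉ VH → z v ≡ 0ℚ
        y-lo   : ∀ i → i ∈ EH → 0ℚ ≤ y i
        y-hi   : ∀ i → i ∈ EH → y i ≤ 1ℚ
        z-lo   : ∀ v → v ∈ VH → 0ℚ ≤ z v
        cap-nC : ∀ v → v ∈ VH → v ∉ C → loadY y v ≤ toℚ (f v) + z v
        cap-C  : ∀ v → v ∈ VH → v ∈ C → loadY y v ≤ toℚ (f v)

    Extreme : (Fin m → ℚ) → (Fin n → ℚ) → Set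
    Extreme y z = ∀ y₁ z₁ y₂ z₂ (λ' : ℚ) → Feas y₁ z₁ → Feas y₂ z₂ → 0ℚ < λ' → λ' < 1ℚ →
      (∀ i → y i ≡ λ' * y₁ i + (1ℚ - λ') * y₂ i) →
      (∀ v → z v ≡ λ' * z₁ v + (1ℚ - λ') * z₂ v) →
      (∀ i → y₁ i ≡ y₂ i) × (∀ v → z₁ v ≡ z₂ v)

    Optimal : (Fin m → ℚ) → (Fin n → ℚ) → Set
    Optimal y z = ∀ y' z' → Feas y' z' → objective y' z' ≤ objective y z

    OptExtreme : (Fin m → ℚ) → (Fin n → ℚ) → Set
    OptExtreme y z = Feas y z × Extreme y z × Optimal y z

  -- Solve ε VH EH C f out : "out is a possible output of SolveIP2((VH,EH), C, f)"
  -- (the algorithm is nondeterministic in the choice of extreme point and edge).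
  data Solve (ε : ℚ) : Subset n → Subset m → Subset n → (Fin n → ℕ) → Subset m → Set where
    done : ∀ {VH EH C f} → (∀ i → i ∉ EH) → Solve ε VH EH C f Data.Fin.Subset.⊥
    drop : ∀ {VH EH C f out} (y : Fin m → ℚ) (z : Fin n → ℚ) →
      LP2.OptExtreme ε (dropIsolated VH EH) EH C f y z →
      ∀ i → i ∈ EH → y i ≡ 0ℚ →
      Solve ε (dropIsolated VH EH) (EH ─ ⁅ i ⁆) C f out →
      Solve ε VH EH C f out
    pick : ∀ {VH EH C f out} (y : Fin m → ℚ) (z : Fin n → ℚ) →
      LP2.OptExtreme ε (dropIsolated VH EH) EH C f y z →
      (∀ j → j ∈ EH → ¬ (y j ≡ 0ℚ)) →
      ∀ i u v → i ∈ EH → (ends i ≡ (u , v) ⊎ ends i ≡ (v , u)) →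
      (+ 1) // 2 ≤ y i → 0 <ℕ f v → z v ≡ 0ℚ →
      Solve ε (dropIsolated VH EH) (EH ─ ⁅ i ⁆) (C ∪ ⁅ v ⁆) (decr u v f) out →
      Solve ε VH EH C f (out ∪ ⁅ i ⁆)

-- Along a run, every vertex already put into C keeps its output
-- degree within its current bound f, and every output edge has an endpoint
-- within it.  A pick of e = (u, v) decrements f at both endpoints, which is
-- harmless: f_v > 0 is required, and an endpoint in C with f = 0 would carry
-- load y_e >= 1/2 against capacity 0.
--
-- The LP value of every feasible point is at most 3 |output|, by
-- induction on the run.  Dropping an edge with y_e = 0 restricts an optimal
-- point to a feasible point of the next LP of the same value.  Picking
-- e = (u, v) with y_e >= 1/2, the other edges at u and at v are scaled down so
-- that their loads fit the decremented capacities; since the load at u was at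
-- most its capacity minus y_e, each scaling loses at most 1 - y_e, so the value
-- drops by at most 2 (y_e + 2 (1 - y_e)) <= 3.  Finally, for feasible F the
-- indicator of F with the excesses z_v = deg_F v ∸ c_v is feasible for the first
-- LP, and as every edge of F has an endpoint within its bound the total excess
-- is at most |F|; so the LP value is at least (1 - ε) |F| >= (1 - ε)^2 |F|.

module Submission where

open import Defs

open import Algebra.Bundles using (Ring)
import Algebra.Properties.CommutativeMonoid.Sum as CommutativeMonoidSum
import Algebra.Properties.CommutativeSemigroup as CommutativeSemigroupProperties
import Algebra.Properties.Semiring.Sum as SemiringSum
open import Data.Bool using (Bool; true; false; if_then_else_; _∧_; _∨_; not)
import Data.Bool.Properties as 𝔹
open import Data.Empty using (⊥-elim)
open import Data.Fin using (Fin; zero; suc; _≟_)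
open import Data.Fin.Subset using (Subset; ⊤; ⊥; _∪_; _─_; ⁅_⁆; _∈_; _∉_; ∣_∣)
open import Data.Fin.Subset.Properties using (∣⊥∣≡0)
open import Data.Integer as ℤ using (+≤+; +<+)
import Data.Integer.Properties as ℤ
open import Data.Nat as ℕ using (ℕ; zero; suc; z≤n; s≤s)
import Data.Nat.Properties as ℕₚ
open import Data.Nat.Coprimality using (1-coprimeTo) renaming (sym to coprime-sym)
open import Data.Product using (Σ; _×_; _,_; proj₁; proj₂)
open import Data.Rational
  using (ℚ; mkℚ; 0ℚ; 1ℚ; *≤*; *<*; _+_; _*_; _-_; -_; _/_; 1/_; _≤_; _<_; NonZero; Positive; nonNegative; positive)
open import Data.Rational.Properties hiding (_≟_)
open import Data.Rational.Solver using (module +-*-Solver)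
open +-*-Solver using (solve; _:+_; _:*_; _:-_; _:=_; con)
open import Data.Sum using (_⊎_; inj₁; inj₂)
open import Data.Vec using (_∷_; []; lookup)
open import Data.Vec.Properties using (lookup-replicate; lookup-zipWith; lookup∘tabulate; lookup⇒[]=; []=⇒lookup)
open import Relation.Nullary using (¬_; yes; no; Dec)
open import Relation.Nullary.Decidable using (⌊_⌋)
open import Relation.Binary.PropositionalEquality

private
  module ℕ+ = CommutativeSemigroupProperties ℕₚ.+-commutativeSemigroup
  module ΣQ = CommutativeMonoidSum +-0-commutativeMonoid
  module ΣQ* = SemiringSum (Ring.semiring +-*-ring)

0≤1 : 0ℚ ≤ 1ℚ
0≤1 = *≤* (+≤+ z≤n)

+-nonNeg : ∀ {p q} → 0ℚ ≤ p → 0ℚ ≤ q → 0ℚ ≤ p + q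
+-nonNeg {p} {q} 0≤p 0≤q = subst (_≤ p + q) (+-identityʳ 0ℚ) (+-mono-≤ 0≤p 0≤q)

*-monoʳ-≤ : ∀ {r p q} → 0ℚ ≤ r → p ≤ q → r * p ≤ r * q
*-monoʳ-≤ {r} 0≤r = *-monoˡ-≤-nonNeg r {{nonNegative 0≤r}}

*-nonNeg : ∀ {p q} → 0ℚ ≤ p → 0ℚ ≤ q → 0ℚ ≤ p * q
*-nonNeg {p} {q} 0≤p 0≤q = subst (_≤ p * q) (*-zeroʳ p) (*-monoʳ-≤ 0≤p 0≤q)

p≤q⇒0≤q-p : ∀ {p q} → p ≤ q → 0ℚ ≤ q - p
p≤q⇒0≤q-p {p} {q} p≤q = subst (_≤ q - p) (+-inverseʳ p) (+-monoˡ-≤ (- p) p≤q)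

*-≤ˡ : ∀ {p q} → 0ℚ ≤ p → q ≤ 1ℚ → p * q ≤ p
*-≤ˡ {p} 0≤p q≤1 = subst (p * _ ≤_) (*-identityʳ p) (*-monoʳ-≤ 0≤p q≤1)

*-≤ʳ : ∀ {p q} → 0ℚ ≤ q → p ≤ 1ℚ → p * q ≤ q
*-≤ʳ {p} {q} 0≤q p≤1 = subst₂ _≤_ (*-comm q p) (*-identityʳ q) (*-monoʳ-≤ 0≤q p≤1)

≤-by-gap : ∀ {p q} r → 0ℚ ≤ r → q ≡ p + r → p ≤ q
≤-by-gap {p} r 0≤r refl = subst (_≤ p + r) (+-identityʳ p) (+-monoʳ-≤ p 0≤r)

half : ℚ
half = ℤ.+ 1 / 2

0<half : 0ℚ < half
0<half = *<* (+<+ (s≤s z≤n))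

toℚ-canonical : ∀ k → toℚ k ≡ mkℚ (ℤ.+ k) 0 (coprime-sym (1-coprimeTo k))
toℚ-canonical k = normalize-coprime (coprime-sym (1-coprimeTo k))

toℚ-+ : ∀ a b → toℚ (a ℕ.+ b) ≡ toℚ a + toℚ b
toℚ-+ a b = sym (trans (cong₂ _+_ (toℚ-canonical a) (toℚ-canonical b))
  (/-cong {q₁ = 1} {q₂ = 1} (cong₂ ℤ._+_ (ℤ.*-identityʳ (ℤ.+ a)) (ℤ.*-identityʳ (ℤ.+ b))) refl))

0≤toℚ : ∀ k → 0ℚ ≤ toℚ k
0≤toℚ k rewrite toℚ-canonical k = nonNegative⁻¹ _

toℚ-mono-≤ : ∀ {a b} → a ℕ.≤ b → toℚ a ≤ toℚ b
toℚ-mono-≤ {a} a≤b with ℕₚ.m≤n⇒∃[o]m+o≡n a≤b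
... | k , refl = ≤-by-gap (toℚ k) (0≤toℚ k) (toℚ-+ a k)

if-nonNeg : ∀ b {x} → 0ℚ ≤ x → 0ℚ ≤ (if b then x else 0ℚ)
if-nonNeg true 0≤x = 0≤x
if-nonNeg false _ = ≤-refl

0≤if-then-1 : ∀ b {s} → 0ℚ ≤ s → 0ℚ ≤ (if b then s else 1ℚ)
0≤if-then-1 true 0≤s = 0≤s
0≤if-then-1 false _ = 0≤1

if-then-1≤1 : ∀ b {s} → s ≤ 1ℚ → (if b then s else 1ℚ) ≤ 1ℚ
if-then-1≤1 true s≤1 = s≤1
if-then-1≤1 false _ = ≤-refl

if-≤ : ∀ b {x c} → x ≤ c → 0ℚ ≤ c → (if b then x else 0ℚ) ≤ c
if-≤ true x≤c _ = x≤c
if-≤ false _ 0≤c = 0≤c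

*-toℚ-suc : ∀ a k → a * toℚ k + a ≡ a * toℚ (suc k)
*-toℚ-suc a k = begin
  a * toℚ k + a          ≡⟨ solve 2 (λ a k → a :* k :+ a := a :* (con 1ℚ :+ k)) refl a (toℚ k) ⟩
  a * (1ℚ + toℚ k)       ≡⟨ cong (a *_) (sym (toℚ-+ 1 k)) ⟩
  a * toℚ (suc k)        ∎
  where open ≡-Reasoning

≟-suc : ∀ {k} (i j : Fin k) → ⌊ suc i ≟ suc j ⌋ ≡ ⌊ i ≟ j ⌋
≟-suc i j with i ≟ j
... | yes _ = refl
... | no _ = refl

≟-refl : ∀ {k} (x : Fin k) → ⌊ x ≟ x ⌋ ≡ true
≟-refl x with x ≟ x
... | yes _ = refl
... | no x≢x = ⊥-elim (x≢x refl)

≟-≢ : ∀ {k} {x y : Fin k} → ¬ x ≡ y → ⌊ x ≟ y ⌋ ≡ false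
≟-≢ {x = x} {y} x≢y with x ≟ y
... | yes x≡y = ⊥-elim (x≢y x≡y)
... | no _ = refl

≟⇒≡ : ∀ {k} {x y : Fin k} → ⌊ x ≟ y ⌋ ≡ true → x ≡ y
≟⇒≡ {x = x} {y} eq with x ≟ y
... | yes x≡y = x≡y
≟⇒≡ () | no _

lookup-⊤ : ∀ {k} (i : Fin k) → lookup (⊤ {k}) i ≡ true
lookup-⊤ i = lookup-replicate i true

lookup-⊥ : ∀ {k} (i : Fin k) → lookup (⊥ {k}) i ≡ false
lookup-⊥ i = lookup-replicate i false

lookup-∪ : ∀ {k} (p q : Subset k) j → lookup (p ∪ q) j ≡ lookup p j ∨ lookup q j
lookup-∪ p q j = lookup-zipWith _∨_ j p q

lookup-─ : ∀ {k} (p q : Subset k) j → lookup (p ─ q) j ≡ lookup p j ∧ not (lookup q j)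
lookup-─ (x ∷ p) (true ∷ q) zero = sym (𝔹.∧-zeroʳ x)
lookup-─ (x ∷ p) (false ∷ q) zero = sym (𝔹.∧-identityʳ x)
lookup-─ (x ∷ p) (y ∷ q) (suc j) = lookup-─ p q j

lookup-⁅⁆ : ∀ {k} (i j : Fin k) → lookup ⁅ i ⁆ j ≡ ⌊ i ≟ j ⌋
lookup-⁅⁆ zero zero = refl
lookup-⁅⁆ zero (suc j) = lookup-⊥ j
lookup-⁅⁆ (suc i) zero = refl
lookup-⁅⁆ (suc i) (suc j) = trans (lookup-⁅⁆ i j) (sym (≟-suc i j))

lookup-─⁅⁆-self : ∀ {k} (p : Subset k) i → lookup (p ─ ⁅ i ⁆) i ≡ false
lookup-─⁅⁆-self p i rewrite lookup-─ p ⁅ i ⁆ i | lookup-⁅⁆ i i | ≟-refl i = 𝔹.∧-zeroʳ _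

lookup-─⁅⁆-other : ∀ {k} (p : Subset k) {i j} → ¬ i ≡ j → lookup (p ─ ⁅ i ⁆) j ≡ lookup p j
lookup-─⁅⁆-other p {i} {j} i≢j rewrite lookup-─ p ⁅ i ⁆ j | lookup-⁅⁆ i j | ≟-≢ i≢j = 𝔹.∧-identityʳ _

lookup-─-⊆ : ∀ {k} (p q : Subset k) j → lookup (p ─ q) j ≡ true → lookup p j ≡ true
lookup-─-⊆ p q j eq = 𝔹.∧-conicalˡ _ _ (trans (sym (lookup-─ p q j)) eq)

lookup-∪⁅⁆ : ∀ {k} (p : Subset k) i j → lookup (p ∪ ⁅ i ⁆) j ≡ lookup p j ∨ ⌊ i ≟ j ⌋
lookup-∪⁅⁆ p i j = trans (lookup-∪ p ⁅ i ⁆ j) (cong (lookup p j ∨_) (lookup-⁅⁆ i j))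

∈⇒lookup : ∀ {k} {i : Fin k} {p : Subset k} → i ∈ p → lookup p i ≡ true
∈⇒lookup = []=⇒lookup

lookup⇒∈ : ∀ {k} {i : Fin k} {p : Subset k} → lookup p i ≡ true → i ∈ p
lookup⇒∈ {i = i} {p} = lookup⇒[]= i p

∉⇒lookup : ∀ {k} {i : Fin k} {p : Subset k} → i ∉ p → lookup p i ≡ false
∉⇒lookup {i = i} {p} i∉p with lookup p i in eq
... | true = ⊥-elim (i∉p (lookup⇒∈ eq))
... | false = refl

lookup-false⇒∉ : ∀ {k} {i : Fin k} {p : Subset k} → lookup p i ≡ false → i ∉ p
lookup-false⇒∉ eq i∈p with () ← trans (sym (∈⇒lookup i∈p)) eq

anyFin-true : ∀ {k} (b : Fin k → Bool) i → b i ≡ true → anyFin b ≡ true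
anyFin-true b zero eq rewrite eq = refl
anyFin-true b (suc i) eq rewrite anyFin-true (λ j → b (suc j)) i eq = 𝔹.∨-zeroʳ (b zero)

count-cong : ∀ {k} {b c : Fin k → Bool} → (∀ i → b i ≡ c i) → count b ≡ count c
count-cong {zero} b≡c = refl
count-cong {suc k} b≡c = cong₂ ℕ._+_ (cong (λ x → if x then 1 else 0) (b≡c zero)) (count-cong (λ i → b≡c (suc i)))

count-false : ∀ k → count {k} (λ _ → false) ≡ 0
count-false zero = refl
count-false (suc k) = count-false k

count-≥1 : ∀ {k} (b : Fin k → Bool) i → b i ≡ true → 1 ℕ.≤ count b
count-≥1 b zero eq rewrite eq = s≤s z≤n
count-≥1 b (suc i) eq = ℕₚ.≤-trans (count-≥1 (λ j → b (suc j)) i eq) (ℕₚ.m≤n+m _ (if b zero then 1 else 0))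

count-insert : ∀ {k} (p q : Fin k → Bool) (i : Fin k) → p i ≡ false →
  count (λ j → (p j ∨ ⌊ i ≟ j ⌋) ∧ q j) ≡ (if q i then 1 else 0) ℕ.+ count (λ j → p j ∧ q j)
count-insert {suc k} p q zero eq rewrite eq =
  cong ((if q zero then 1 else 0) ℕ.+_) (count-cong (λ j → cong (_∧ q (suc j)) (𝔹.∨-identityʳ (p (suc j)))))
count-insert {suc k} p q (suc i) eq = begin
  indicator₀ ℕ.+ count (λ j → (p (suc j) ∨ ⌊ suc i ≟ suc j ⌋) ∧ q (suc j))
    ≡⟨ cong₂ ℕ._+_ (cong (λ x → if x ∧ q zero then 1 else 0) (𝔹.∨-identityʳ (p zero)))
                   (count-cong (λ j → cong (λ x → (p (suc j) ∨ x) ∧ q (suc j)) (≟-suc i j))) ⟩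
  (if p zero ∧ q zero then 1 else 0) ℕ.+ count (λ j → (p (suc j) ∨ ⌊ i ≟ j ⌋) ∧ q (suc j))
    ≡⟨ cong ((if p zero ∧ q zero then 1 else 0) ℕ.+_) (count-insert (λ j → p (suc j)) (λ j → q (suc j)) i eq) ⟩
  (if p zero ∧ q zero then 1 else 0) ℕ.+ ((if q (suc i) then 1 else 0) ℕ.+ count (λ j → p (suc j) ∧ q (suc j)))
    ≡⟨ ℕ+.x∙yz≈y∙xz (if p zero ∧ q zero then 1 else 0) (if q (suc i) then 1 else 0) _ ⟩
  (if q (suc i) then 1 else 0) ℕ.+ count (λ j → p j ∧ q j)  ∎
  where
    open ≡-Reasoning
    indicator₀ = if (p zero ∨ ⌊ suc i ≟ zero ⌋) ∧ q zero then 1 else 0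

count-∨-≤ : ∀ {k} (p q r : Fin k → Bool) →
  count (λ v → (p v ∨ q v) ∧ r v) ℕ.≤ count (λ v → p v ∧ r v) ℕ.+ count (λ v → q v ∧ r v)
count-∨-≤ {zero} p q r = z≤n
count-∨-≤ {suc k} p q r = ℕₚ.≤-trans
  (ℕₚ.+-mono-≤ (indicator-∨-≤ (p zero) (q zero) (r zero)) (count-∨-≤ (λ j → p (suc j)) (λ j → q (suc j)) (λ j → r (suc j))))
  (ℕₚ.≤-reflexive (ℕ+.interchange (if p zero ∧ r zero then 1 else 0) (if q zero ∧ r zero then 1 else 0) _ _))
  where
    indicator-∨-≤ : ∀ a b c → (if (a ∨ b) ∧ c then 1 else 0) ℕ.≤ (if a ∧ c then 1 else 0) ℕ.+ (if b ∧ c then 1 else 0)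
    indicator-∨-≤ true  b     true  = s≤s z≤n
    indicator-∨-≤ false true  true  = s≤s z≤n
    indicator-∨-≤ false false true  = z≤n
    indicator-∨-≤ a     b     false rewrite 𝔹.∧-zeroʳ (a ∨ b) = z≤n

count-≟-∧ : ∀ {k} (a : Fin k) (b : Fin k → Bool) → count (λ v → ⌊ v ≟ a ⌋ ∧ b v) ≡ (if b a then 1 else 0)
count-≟-∧ {suc k} zero b = trans (cong ((if b zero then 1 else 0) ℕ.+_) (count-false k)) (ℕₚ.+-identityʳ _)
count-≟-∧ {suc k} (suc a) b = trans (count-cong (λ j → cong (_∧ b (suc j)) (≟-suc j a))) (count-≟-∧ a (λ j → b (suc j)))

∣p∣≡count : ∀ {k} (p : Subset k) → ∣ p ∣ ≡ count (lookup p)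
∣p∣≡count [] = refl
∣p∣≡count (true ∷ p) = cong suc (∣p∣≡count p)
∣p∣≡count (false ∷ p) = ∣p∣≡count p

∣p∪⁅i⁆∣ : ∀ {k} (p : Subset k) i → lookup p i ≡ false → ∣ p ∪ ⁅ i ⁆ ∣ ≡ suc ∣ p ∣
∣p∪⁅i⁆∣ p i i∉p = begin
  ∣ p ∪ ⁅ i ⁆ ∣                                   ≡⟨ ∣p∣≡count (p ∪ ⁅ i ⁆) ⟩
  count (lookup (p ∪ ⁅ i ⁆))                      ≡⟨ count-cong (λ j → trans (lookup-∪⁅⁆ p i j) (sym (𝔹.∧-identityʳ _))) ⟩
  count (λ j → (lookup p j ∨ ⌊ i ≟ j ⌋) ∧ true)  ≡⟨ count-insert (lookup p) (λ _ → true) i i∉p ⟩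
  suc (count (λ j → lookup p j ∧ true))          ≡⟨ cong suc (count-cong (λ j → 𝔹.∧-identityʳ (lookup p j))) ⟩
  suc (count (lookup p))                         ≡⟨ cong suc (sym (∣p∣≡count p)) ⟩
  suc ∣ p ∣                                       ∎
  where open ≡-Reasoning

1+≤⇐≤∸1 : ∀ {a b} → 1 ℕ.≤ a → b ℕ.≤ a ℕ.∸ 1 → 1 ℕ.+ b ℕ.≤ a
1+≤⇐≤∸1 {suc a} _ b≤a∸1 = s≤s b≤a∸1

∑-cong : ∀ {k} {g h : Fin k → ℚ} → (∀ i → g i ≡ h i) → ∑ g ≡ ∑ h
∑-cong {zero} g≡h = refl
∑-cong {suc k} g≡h = cong₂ _+_ (g≡h zero) (∑-cong (λ i → g≡h (suc i)))

∑-mono-≤ : ∀ {k} {g h : Fin k → ℚ} → (∀ i → g i ≤ h i) → ∑ g ≤ ∑ h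
∑-mono-≤ {zero} g≤h = ≤-refl
∑-mono-≤ {suc k} g≤h = +-mono-≤ (g≤h zero) (∑-mono-≤ (λ i → g≤h (suc i)))

∑≡sum : ∀ {k} (g : Fin k → ℚ) → ∑ g ≡ ΣQ.sum g
∑≡sum {zero} g = refl
∑≡sum {suc k} g = cong (λ t → g zero + t) (∑≡sum (λ i → g (suc i)))

∑-zero : ∀ k → ∑ {k} (λ _ → 0ℚ) ≡ 0ℚ
∑-zero k = trans (∑≡sum {k} (λ _ → 0ℚ)) (ΣQ.sum-replicate-zero k)

∑-distrib-+ : ∀ {k} (g h : Fin k → ℚ) → ∑ (λ i → g i + h i) ≡ ∑ g + ∑ h
∑-distrib-+ g h = begin
  ∑ (λ i → g i + h i)  ≡⟨ ∑≡sum (λ i → g i + h i) ⟩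
  ΣQ.sum (λ i → g i + h i)  ≡⟨ ΣQ.∑-distrib-+ g h ⟩
  ΣQ.sum g + ΣQ.sum h  ≡⟨ sym (cong₂ _+_ (∑≡sum g) (∑≡sum h)) ⟩
  ∑ g + ∑ h  ∎
  where open ≡-Reasoning

*-distribˡ-∑ : ∀ {k} c (g : Fin k → ℚ) → c * ∑ g ≡ ∑ (λ i → c * g i)
*-distribˡ-∑ c g = begin
  c * ∑ g  ≡⟨ cong (c *_) (∑≡sum g) ⟩
  c * ΣQ.sum g  ≡⟨ ΣQ*.*-distribˡ-sum c g ⟩
  ΣQ.sum (λ i → c * g i)  ≡⟨ sym (∑≡sum (λ i → c * g i)) ⟩
  ∑ (λ i → c * g i)  ∎
  where open ≡-Reasoning

∑-comm : ∀ {k l} (g : Fin k → Fin l → ℚ) → ∑ (λ i → ∑ (g i)) ≡ ∑ (λ j → ∑ (λ i → g i j))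
∑-comm g = begin
  ∑ (λ i → ∑ (g i))  ≡⟨ trans (∑-cong (λ i → ∑≡sum (g i))) (∑≡sum (λ i → ΣQ.sum (g i))) ⟩
  ΣQ.sum (λ i → ΣQ.sum (g i))  ≡⟨ ΣQ.∑-comm g ⟩
  ΣQ.sum (λ j → ΣQ.sum (λ i → g i j))
    ≡⟨ sym (trans (∑-cong (λ j → ∑≡sum (λ i → g i j))) (∑≡sum (λ j → ΣQ.sum (λ i → g i j)))) ⟩
  ∑ (λ j → ∑ (λ i → g i j))  ∎
  where open ≡-Reasoning

∑-nonNeg : ∀ {k} {g : Fin k → ℚ} → (∀ i → 0ℚ ≤ g i) → 0ℚ ≤ ∑ g
∑-nonNeg {k} {g} 0≤g = subst (_≤ ∑ g) (∑-zero k) (∑-mono-≤ 0≤g)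

∑-select : ∀ {k} (i : Fin k) (g : Fin k → ℚ) → ∑ (λ j → if ⌊ i ≟ j ⌋ then g j else 0ℚ) ≡ g i
∑-select {suc k} zero g = trans (cong (g zero +_) (∑-zero k)) (+-identityʳ (g zero))
∑-select {suc k} (suc i) g = trans (+-identityˡ _)
  (trans (∑-cong (λ j → cong (λ b → if b then g (suc j) else 0ℚ) (≟-suc i j))) (∑-select i (λ j → g (suc j))))

term≤∑ : ∀ {k} (g : Fin k → ℚ) → (∀ j → 0ℚ ≤ g j) → ∀ i → g i ≤ ∑ g
term≤∑ g 0≤g i = subst (_≤ ∑ g) (∑-select i g) (∑-mono-≤ select≤)
  where
    select≤ : ∀ j → (if ⌊ i ≟ j ⌋ then g j else 0ℚ) ≤ g j
    select≤ j with ⌊ i ≟ j ⌋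
    ... | true = ≤-refl
    ... | false = 0≤g j

∑-remove : ∀ {k} (g g′ : Fin k → Bool) (y : Fin k → ℚ) i → g i ≡ true → g′ i ≡ false → (∀ j → ¬ i ≡ j → g′ j ≡ g j) →
  ∑ (λ j → if g j then y j else 0ℚ) ≡ ∑ (λ j → if g′ j then y j else 0ℚ) + y i
∑-remove g g′ y i gi g′i g′≡g = begin
  ∑ (λ j → if g j then y j else 0ℚ)
    ≡⟨ ∑-cong split ⟩
  ∑ (λ j → (if g′ j then y j else 0ℚ) + (if ⌊ i ≟ j ⌋ then y j else 0ℚ))
    ≡⟨ ∑-distrib-+ (λ j → if g′ j then y j else 0ℚ) (λ j → if ⌊ i ≟ j ⌋ then y j else 0ℚ) ⟩
  ∑ (λ j → if g′ j then y j else 0ℚ) + ∑ (λ j → if ⌊ i ≟ j ⌋ then y j else 0ℚ)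
    ≡⟨ cong (∑ (λ j → if g′ j then y j else 0ℚ) +_) (∑-select i y) ⟩
  ∑ (λ j → if g′ j then y j else 0ℚ) + y i  ∎
  where
    open ≡-Reasoning
    split : ∀ j → (if g j then y j else 0ℚ) ≡ (if g′ j then y j else 0ℚ) + (if ⌊ i ≟ j ⌋ then y j else 0ℚ)
    split j with i ≟ j
    ... | yes refl rewrite gi | g′i = sym (+-identityˡ (y i))
    ... | no i≢j rewrite g′≡g j i≢j = sym (+-identityʳ _)

toℚ-count : ∀ {k} (b : Fin k → Bool) → toℚ (count b) ≡ ∑ (λ j → if b j then 1ℚ else 0ℚ)
toℚ-count {zero} b = refl
toℚ-count {suc k} b with b zero
... | true = trans (toℚ-+ 1 (count (λ i → b (suc i)))) (cong (1ℚ +_) (toℚ-count (λ i → b (suc i))))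
... | false = trans (toℚ-+ 0 (count (λ i → b (suc i)))) (cong (0ℚ +_) (toℚ-count (λ i → b (suc i))))

record ShrinkFactor (T R : ℚ) : Set where
  field
    factor : ℚ
    0≤factor : 0ℚ ≤ factor
    factor≤1 : factor ≤ 1ℚ
    factor*R≤T : factor * R ≤ T
    loss≤ : ∀ δ → 0ℚ ≤ δ → R ≤ T + δ → (1ℚ - factor) * R ≤ δ

shrinkFactor : ∀ T R → 0ℚ ≤ T → 0ℚ ≤ R → ShrinkFactor T R
shrinkFactor T R 0≤T 0≤R with R ≤? T
... | yes R≤T = record
  { factor = 1ℚ ; 0≤factor = 0≤1 ; factor≤1 = ≤-refl
  ; factor*R≤T = subst (_≤ T) (sym (*-identityˡ R)) R≤T
  ; loss≤ = λ δ 0≤δ _ → subst (_≤ δ) (solve 1 (λ R → con 0ℚ := (con 1ℚ :- con 1ℚ) :* R) refl R) 0≤δ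
  }
... | no R≰T = record
  { factor = s ; 0≤factor = 0≤s ; factor≤1 = s≤1 ; factor*R≤T = ≤-reflexive s*R≡T
  ; loss≤ = λ δ _ R≤T+δ → ≤-by-gap (T + δ - R) (p≤q⇒0≤q-p R≤T+δ) (gap δ)
  }
  where
    T<R = ≰⇒> R≰T
    instance
      R-pos : Positive R
      R-pos = positive (≤-<-trans 0≤T T<R)
      R-nonZero : NonZero R
      R-nonZero = pos⇒nonZero R
    s = T * 1/ R
    s*R≡T : s * R ≡ T
    s*R≡T = trans (*-assoc T (1/ R) R) (trans (cong (T *_) (*-inverseˡ R)) (*-identityʳ T))
    0≤s : 0ℚ ≤ s
    0≤s = *-nonNeg 0≤T (<⇒≤ (positive⁻¹ (1/ R) {{1/pos⇒pos R}}))
    s≤1 : s ≤ 1ℚ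
    s≤1 = *-cancelʳ-≤-pos R (subst₂ _≤_ (sym s*R≡T) (sym (*-identityˡ R)) (<⇒≤ T<R))
    gap : ∀ δ → δ ≡ (1ℚ - s) * R + (T + δ - R)
    gap δ = trans (solve 3 (λ s R δ → δ := (con 1ℚ :- s) :* R :+ (s :* R :+ δ :- R)) refl s R δ)
                  (cong (λ t → (1ℚ - s) * R + (t + δ - R)) s*R≡T)

shrink-both-loss : ∀ (bu bv : Bool) {y su sv} → 0ℚ ≤ y → su ≤ 1ℚ → sv ≤ 1ℚ →
  y ≤ y * ((if bu then su else 1ℚ) * (if bv then sv else 1ℚ))
      + (1ℚ - su) * (if bu then y else 0ℚ) + (1ℚ - sv) * (if bv then y else 0ℚ)
shrink-both-loss true true {y} {su} {sv} 0≤y su≤1 sv≤1 =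
  ≤-by-gap (y * (1ℚ - su) * (1ℚ - sv)) (*-nonNeg (*-nonNeg 0≤y (p≤q⇒0≤q-p su≤1)) (p≤q⇒0≤q-p sv≤1))
    (solve 3 (λ y a b → y :* (a :* b) :+ (con 1ℚ :- a) :* y :+ (con 1ℚ :- b) :* y
                := y :+ y :* (con 1ℚ :- a) :* (con 1ℚ :- b)) refl y su sv)
shrink-both-loss true false {y} {su} {sv} _ _ _ = ≤-reflexive
  (solve 3 (λ y a b → y := y :* (a :* con 1ℚ) :+ (con 1ℚ :- a) :* y :+ (con 1ℚ :- b) :* con 0ℚ) refl y su sv)
shrink-both-loss false true {y} {su} {sv} _ _ _ = ≤-reflexive
  (solve 3 (λ y a b → y := y :* (con 1ℚ :* b) :+ (con 1ℚ :- a) :* con 0ℚ :+ (con 1ℚ :- b) :* y) refl y su sv)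
shrink-both-loss false false {y} {su} {sv} _ _ _ = ≤-reflexive
  (solve 3 (λ y a b → y := y :* (con 1ℚ :* con 1ℚ) :+ (con 1ℚ :- a) :* con 0ℚ :+ (con 1ℚ :- b) :* con 0ℚ) refl y su sv)

restricted-shrink-loss : ∀ (b bu bv : Bool) {y su sv} → 0ℚ ≤ y → su ≤ 1ℚ → sv ≤ 1ℚ →
  (if b then y else 0ℚ)
    ≤ (if b then (if b then y * ((if bu then su else 1ℚ) * (if bv then sv else 1ℚ)) else 0ℚ) else 0ℚ)
      + (1ℚ - su) * (if b ∧ bu then y else 0ℚ) + (1ℚ - sv) * (if b ∧ bv then y else 0ℚ)
restricted-shrink-loss true bu bv 0≤y su≤1 sv≤1 = shrink-both-loss bu bv 0≤y su≤1 sv≤1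
restricted-shrink-loss false bu bv {su = su} {sv} _ _ _ =
  ≤-reflexive (solve 2 (λ a b → con 0ℚ := con 0ℚ :+ a :* con 0ℚ :+ b :* con 0ℚ) refl (1ℚ - su) (1ℚ - sv))

if-restricted-*-≤ : ∀ (b c : Bool) {x k s} → 0ℚ ≤ x → (c ≡ true → k ≤ s) →
  (if b ∧ c then (if b then x * k else 0ℚ) else 0ℚ) ≤ s * (if b ∧ c then x else 0ℚ)
if-restricted-*-≤ true true {x} {k} {s} 0≤x k≤s = subst (x * k ≤_) (*-comm x s) (*-monoʳ-≤ 0≤x (k≤s refl))
if-restricted-*-≤ true false {s = s} _ _ = ≤-reflexive (sym (*-zeroʳ s))
if-restricted-*-≤ false c {s = s} _ _ = ≤-reflexive (sym (*-zeroʳ s))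

heavy-edge-loss : ∀ y a b → half ≤ y → a ≤ 1ℚ - y → b ≤ 1ℚ - y → toℚ 2 * (y + a + b) ≤ toℚ 3
heavy-edge-loss y a b half≤y a≤ b≤ = ≤-trans
  (*-monoʳ-≤ (0≤toℚ 2) (+-mono-≤ (+-monoʳ-≤ y a≤) b≤))
  (≤-by-gap (toℚ 2 * (y - half)) (*-nonNeg (0≤toℚ 2) (p≤q⇒0≤q-p half≤y))
    (solve 1 (λ y → con (toℚ 3) := con (toℚ 2) :* (y :+ (con 1ℚ :- y) :+ (con 1ℚ :- y)) :+ con (toℚ 2) :* (y :- con half))
           refl y))

objective-step : ∀ ε Y Y′ Z Z′ L → 0ℚ ≤ 1ℚ + ε → Y ≤ Y′ + L → Z′ ≤ Z →
  toℚ 2 * Y - (1ℚ + ε) * Z ≤ (toℚ 2 * Y′ - (1ℚ + ε) * Z′) + toℚ 2 * L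
objective-step ε Y Y′ Z Z′ L 0≤1+ε Y≤Y′+L Z′≤Z =
  ≤-by-gap (toℚ 2 * (Y′ + L - Y) + (1ℚ + ε) * (Z - Z′))
    (+-nonNeg (*-nonNeg (0≤toℚ 2) (p≤q⇒0≤q-p Y≤Y′+L)) (*-nonNeg 0≤1+ε (p≤q⇒0≤q-p Z′≤Z)))
    (solve 7 (λ t e Y Y′ Z Z′ L → (t :* Y′ :- (con 1ℚ :+ e) :* Z′) :+ t :* L
                := (t :* Y :- (con 1ℚ :+ e) :* Z) :+ (t :* (Y′ :+ L :- Y) :+ (con 1ℚ :+ e) :* (Z :- Z′)))
             refl (toℚ 2) ε Y Y′ Z Z′ L)

approximation-arithmetic : ∀ ε F Z O → 0ℚ ≤ ε → ε ≤ 1ℚ → 0ℚ ≤ F → Z ≤ F →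
  toℚ 2 * F - (1ℚ + ε) * Z ≤ O → (1ℚ - ε) * (1ℚ - ε) * F ≤ O
approximation-arithmetic ε F Z O 0≤ε ε≤1 0≤F Z≤F lp≤O = ≤-trans
  (≤-by-gap ((1ℚ + ε) * (F - Z) + ε * (1ℚ - ε) * F)
    (+-nonNeg (*-nonNeg (+-nonNeg 0≤1 0≤ε) (p≤q⇒0≤q-p Z≤F)) (*-nonNeg (*-nonNeg 0≤ε (p≤q⇒0≤q-p ε≤1)) 0≤F))
    (solve 3 (λ e F Z → con (toℚ 2) :* F :- (con 1ℚ :+ e) :* Z
                 := (con 1ℚ :- e) :* (con 1ℚ :- e) :* F :+ ((con 1ℚ :+ e) :* (F :- Z) :+ e :* (con 1ℚ :- e) :* F))
           refl ε F Z))
  lp≤O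

module _ {n m : ℕ} (G : Graph n m) where
  open Graph G

  Joins : Fin m → Fin n → Fin n → Set
  Joins i u v = ends i ≡ (u , v) ⊎ ends i ≡ (v , u)

  inc-joinsˡ : ∀ {i u v} → Joins i u v → inc G u i ≡ true
  inc-joinsˡ {u = u} (inj₁ refl) rewrite ≟-refl u = refl
  inc-joinsˡ {u = u} (inj₂ refl) rewrite ≟-refl u = 𝔹.∨-zeroʳ _

  inc-joinsʳ : ∀ {i u v} → Joins i u v → inc G v i ≡ true
  inc-joinsʳ {v = v} (inj₁ refl) rewrite ≟-refl v = 𝔹.∨-zeroʳ _
  inc-joinsʳ {v = v} (inj₂ refl) rewrite ≟-refl v = refl

  inc-joins-other : ∀ {i u v w} → Joins i u v → ¬ w ≡ u → ¬ w ≡ v → inc G w i ≡ false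
  inc-joins-other (inj₁ refl) w≢u w≢v rewrite ≟-≢ w≢u | ≟-≢ w≢v = refl
  inc-joins-other (inj₂ refl) w≢u w≢v rewrite ≟-≢ w≢u | ≟-≢ w≢v = refl

  joins-≢ : ∀ {i u v} → Joins i u v → ¬ u ≡ v
  joins-≢ {i} (inj₁ eq) u≡v = loopless i (trans (cong proj₁ eq) (trans u≡v (sym (cong proj₂ eq))))
  joins-≢ {i} (inj₂ eq) u≡v = loopless i (trans (cong proj₁ eq) (trans (sym u≡v) (sym (cong proj₂ eq))))

  inc⇒end : ∀ {w i} → inc G w i ≡ true → w ≡ proj₁ (ends i) ⊎ w ≡ proj₂ (ends i)
  inc⇒end {w} {i} eq with w ≟ proj₁ (ends i) | w ≟ proj₂ (ends i)
  ... | yes p | _ = inj₁ p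
  ... | no _ | yes p = inj₂ p
  inc⇒end () | no _ | no _

  deg-⊥ : ∀ w → deg G ⊥ w ≡ 0
  deg-⊥ w = trans (count-cong (λ j → cong (_∧ inc G w j) (lookup-⊥ j))) (count-false m)

  deg-∪⁅⁆ : ∀ out i w → lookup out i ≡ false → deg G (out ∪ ⁅ i ⁆) w ≡ (if inc G w i then 1 else 0) ℕ.+ deg G out w
  deg-∪⁅⁆ out i w i∉out =
    trans (count-cong (λ j → cong (_∧ inc G w j) (lookup-∪⁅⁆ out i j))) (count-insert (lookup out) (inc G w) i i∉out)

  deg-≥1 : ∀ out i w → lookup out i ≡ true → inc G w i ≡ true → 1 ℕ.≤ deg G out w
  deg-≥1 out i w i∈out w∈i = count-≥1 _ i (cong₂ _∧_ i∈out w∈i)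

  decr-joinedˡ : ∀ u v f → decr G u v f u ≡ f u ℕ.∸ 1
  decr-joinedˡ u v f rewrite ≟-refl u = refl

  decr-joinedʳ : ∀ u v f → decr G u v f v ≡ f v ℕ.∸ 1
  decr-joinedʳ u v f rewrite ≟-refl v | 𝔹.∨-zeroʳ ⌊ v ≟ u ⌋ = refl

  decr-other : ∀ {u v} f {w} → ¬ w ≡ u → ¬ w ≡ v → decr G u v f w ≡ f w
  decr-other f w≢u w≢v rewrite ≟-≢ w≢u | ≟-≢ w≢v = refl

  deg-∪⁅⁆-≤ : ∀ {i u v} f out w → Joins i u v → lookup out i ≡ false →
    deg G out w ℕ.≤ decr G u v f w → ((w ≡ u ⊎ w ≡ v) → 1 ℕ.≤ f w) → deg G (out ∪ ⁅ i ⁆) w ℕ.≤ f w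
  deg-∪⁅⁆-≤ {i} {u} {v} f out w i-uv i∉out d≤f′ f≥1 rewrite deg-∪⁅⁆ out i w i∉out with w ≟ u | w ≟ v
  ... | yes refl | _ rewrite inc-joinsˡ i-uv = 1+≤⇐≤∸1 (f≥1 (inj₁ refl)) d≤f′
  ... | no _ | yes refl rewrite inc-joinsʳ i-uv = 1+≤⇐≤∸1 (f≥1 (inj₂ refl)) d≤f′
  ... | no w≢u | no w≢v rewrite inc-joins-other i-uv w≢u w≢v = d≤f′

  record Covers (VH : Subset n) (EH : Subset m) : Set where
    constructor covers
    field covered : ∀ j w → lookup EH j ≡ true → inc G w j ≡ true → lookup VH w ≡ true
  open Covers

  covers-⊤ : Covers ⊤ ⊤
  covers-⊤ = covers λ _ w _ _ → lookup-⊤ w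

  lookup-dropIsolated : ∀ VH EH v →
    lookup (dropIsolated G VH EH) v ≡ lookup VH v ∧ anyFin (λ i → lookup EH i ∧ inc G v i)
  lookup-dropIsolated VH EH v = lookup∘tabulate _ v

  dropIsolated-⊆ : ∀ VH EH v → lookup (dropIsolated G VH EH) v ≡ true → lookup VH v ≡ true
  dropIsolated-⊆ VH EH v eq = 𝔹.∧-conicalˡ _ _ (trans (sym (lookup-dropIsolated VH EH v)) eq)

  covered-dropIsolated : ∀ {VH EH} → Covers VH EH →
    ∀ j w → lookup EH j ≡ true → inc G w j ≡ true → lookup (dropIsolated G VH EH) w ≡ true
  covered-dropIsolated {VH} {EH} cov j w j∈EH w∈j =
    trans (lookup-dropIsolated VH EH w) (cong₂ _∧_ (covered cov j w j∈EH w∈j) (anyFin-true _ j (cong₂ _∧_ j∈EH w∈j)))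

  covers-step : ∀ {VH EH} i → Covers VH EH → Covers (dropIsolated G VH EH) (EH ─ ⁅ i ⁆)
  covers-step {VH} {EH} i cov = covers λ j w j∈EH′ → covered-dropIsolated cov j w (lookup-─-⊆ EH ⁅ i ⁆ j j∈EH′)

  Solve-⊆ : ∀ {ε VH EH C f out} → Solve G ε VH EH C f out → ∀ j → lookup out j ≡ true → lookup EH j ≡ true
  Solve-⊆ (done _) j j∈⊥ with () ← trans (sym (lookup-⊥ j)) j∈⊥
  Solve-⊆ (drop {EH = EH} _ _ _ i _ _ s) j j∈out = lookup-─-⊆ EH ⁅ i ⁆ j (Solve-⊆ s j j∈out)
  Solve-⊆ (pick {EH = EH} {out = out} _ _ _ _ i _ _ i∈EH _ _ _ _ s) j j∈out′ with lookup out j in j∈out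
  ... | true = lookup-─-⊆ EH ⁅ i ⁆ j (Solve-⊆ s j j∈out)
  ... | false rewrite lookup-∪⁅⁆ out i j | j∈out with refl ← ≟⇒≡ j∈out′ = ∈⇒lookup i∈EH

  Solve-fresh : ∀ {ε VH EH C f out} → Solve G ε VH EH C f out → ∀ i → lookup EH i ≡ false → lookup out i ≡ false
  Solve-fresh {out = out} s i i∉EH with lookup out i in i∈out
  ... | false = refl
  ... | true = trans (sym (Solve-⊆ s i i∈out)) i∉EH

  load : Subset m → (Fin m → ℚ) → Fin n → ℚ
  load EH y w = ∑ (λ i → if lookup EH i ∧ inc G w i then y i else 0ℚ)

  capacity : Subset n → (Fin n → ℕ) → (Fin n → ℚ) → Fin n → ℚ
  capacity C f z w = toℚ (f w) + (if lookup C w then 0ℚ else z w)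

  module _ {ε VH EH C f} {y : Fin m → ℚ} {z : Fin n → ℚ} (feas : LP2.Feas G ε VH EH C f y z) where
    open LP2.Feas feas

    y-nonNeg : ∀ j → 0ℚ ≤ y j
    y-nonNeg j with lookup EH j in eq
    ... | true = y-lo j (lookup⇒∈ eq)
    ... | false = ≤-reflexive (sym (y-out j (lookup-false⇒∉ eq)))

    y≤1 : ∀ j → y j ≤ 1ℚ
    y≤1 j with lookup EH j in eq
    ... | true = y-hi j (lookup⇒∈ eq)
    ... | false = subst (_≤ 1ℚ) (sym (y-out j (lookup-false⇒∉ eq))) 0≤1

    z-nonNeg : ∀ v → 0ℚ ≤ z v
    z-nonNeg v with lookup VH v in eq
    ... | true = z-lo v (lookup⇒∈ eq)
    ... | false = ≤-reflexive (sym (z-out v (lookup-false⇒∉ eq)))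

    load≤capacity : ∀ w → lookup VH w ≡ true → load EH y w ≤ capacity C f z w
    load≤capacity w w∈VH with lookup C w in eq
    ... | true = subst (load EH y w ≤_) (sym (+-identityʳ _)) (cap-C w (lookup⇒∈ w∈VH) (lookup⇒∈ eq))
    ... | false = cap-nC w (lookup⇒∈ w∈VH) (lookup-false⇒∉ eq)

  feas-intro : ∀ {ε VH EH C f y z} →
    (∀ j → lookup EH j ≡ false → y j ≡ 0ℚ) → (∀ v → lookup VH v ≡ false → z v ≡ 0ℚ) →
    (∀ j → 0ℚ ≤ y j) → (∀ j → y j ≤ 1ℚ) → (∀ v → 0ℚ ≤ z v) →
    (∀ w → lookup VH w ≡ true → load EH y w ≤ capacity C f z w) → LP2.Feas G ε VH EH C f y z
  feas-intro {EH = EH} {C} {f} {y} {z} y-out z-out 0≤y y≤1 0≤z load≤cap = record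
    { y-out = λ i i∉EH → y-out i (∉⇒lookup i∉EH)
    ; z-out = λ v v∉VH → z-out v (∉⇒lookup v∉VH)
    ; y-lo = λ i _ → 0≤y i
    ; y-hi = λ i _ → y≤1 i
    ; z-lo = λ v _ → 0≤z v
    ; cap-nC = λ v v∈VH v∉C → subst (λ b → load EH y v ≤ toℚ (f v) + (if b then 0ℚ else z v))
                                    (∉⇒lookup v∉C) (load≤cap v (∈⇒lookup v∈VH))
    ; cap-C = λ v v∈VH v∈C → subst (load EH y v ≤_) (+-identityʳ (toℚ (f v)))
                (subst (λ b → load EH y v ≤ toℚ (f v) + (if b then 0ℚ else z v)) (∈⇒lookup v∈C) (load≤cap v (∈⇒lookup v∈VH)))
    }

  -- Feasibility of the output

  record DegreeBounds (C : Subset n) (f : Fin n → ℕ) (out : Subset m) : Set where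
    field
      bounded-in-C : ∀ w → lookup C w ≡ true → deg G out w ℕ.≤ f w
      bounded-end : ∀ i → lookup out i ≡ true → Σ (Fin n) λ w → inc G w i ≡ true × deg G out w ℕ.≤ f w

  degreeBounds-⊥ : ∀ {C f} → DegreeBounds C f ⊥
  degreeBounds-⊥ = record
    { bounded-in-C = λ w _ → subst (ℕ._≤ _) (sym (deg-⊥ w)) z≤n
    ; bounded-end = λ i i∈⊥ → ⊥-elim (𝔹.not-¬ refl (trans (sym (lookup-⊥ i)) i∈⊥))
    }

  degreeBounds-∪⁅⁆ : ∀ {i u v C f out} → Joins i u v → lookup out i ≡ false → 1 ℕ.≤ f v →
    (∀ w → lookup C w ≡ true → (w ≡ u ⊎ w ≡ v) → 1 ℕ.≤ f w) →
    DegreeBounds (C ∪ ⁅ v ⁆) (decr G u v f) out → DegreeBounds C f (out ∪ ⁅ i ⁆)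
  degreeBounds-∪⁅⁆ {i} {u} {v} {C} {f} {out} i-uv i∉out fv≥1 f≥1-in-C bounds = record
    { bounded-in-C = λ w w∈C →
        deg-∪⁅⁆-≤ f out w i-uv i∉out (bounded-in-C w (trans (lookup-∪ C ⁅ v ⁆ w) (cong (_∨ _) w∈C))) (f≥1-in-C w w∈C)
    ; bounded-end = bounded-end′
    }
    where
      open DegreeBounds bounds

      v∈C∪⁅v⁆ : lookup (C ∪ ⁅ v ⁆) v ≡ true
      v∈C∪⁅v⁆ = trans (lookup-∪⁅⁆ C v v) (trans (cong (lookup C v ∨_) (≟-refl v)) (𝔹.∨-zeroʳ _))

      f≥1-at-end : ∀ j w → lookup out j ≡ true → inc G w j ≡ true → deg G out w ℕ.≤ decr G u v f w →
                   (w ≡ u ⊎ w ≡ v) → 1 ℕ.≤ f w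
      f≥1-at-end j w j∈out w∈j d≤f′ w∈uv = ℕₚ.≤-trans (ℕₚ.≤-trans (deg-≥1 out j w j∈out w∈j) d≤f′) (decr≤ w∈uv)
        where
          decr≤ : (w ≡ u ⊎ w ≡ v) → decr G u v f w ℕ.≤ f w
          decr≤ (inj₁ refl) = ℕₚ.≤-trans (ℕₚ.≤-reflexive (decr-joinedˡ u v f)) (ℕₚ.m∸n≤m (f u) 1)
          decr≤ (inj₂ refl) = ℕₚ.≤-trans (ℕₚ.≤-reflexive (decr-joinedʳ u v f)) (ℕₚ.m∸n≤m (f v) 1)

      bounded-end′ : ∀ j → lookup (out ∪ ⁅ i ⁆) j ≡ true → Σ (Fin n) λ w → inc G w j ≡ true × deg G (out ∪ ⁅ i ⁆) w ℕ.≤ f w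
      bounded-end′ j j∈out′ with lookup out j in j∈out
      ... | true with bounded-end j j∈out
      ...   | w , w∈j , d≤f′ = w , w∈j , deg-∪⁅⁆-≤ f out w i-uv i∉out d≤f′ (f≥1-at-end j w j∈out w∈j d≤f′)
      bounded-end′ j j∈out′ | false rewrite lookup-∪⁅⁆ out i j | j∈out with refl ← ≟⇒≡ j∈out′ =
        v , inc-joinsʳ i-uv , deg-∪⁅⁆-≤ f out v i-uv i∉out (bounded-in-C v v∈C∪⁅v⁆) (λ _ → fv≥1)

  f≥1-at-heavy-edge : ∀ {ε VH EH C f y z} → LP2.Feas G ε (dropIsolated G VH EH) EH C f y z → Covers VH EH →
    ∀ i w → lookup EH i ≡ true → inc G w i ≡ true → lookup C w ≡ true → half ≤ y i → 1 ℕ.≤ f w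
  f≥1-at-heavy-edge {VH = VH} {EH} {C} {f} {y} feas cov i w i∈EH w∈i w∈C half≤yi with f w in fw≡
  ... | suc _ = s≤s z≤n
  ... | zero = ⊥-elim (<-irrefl refl (<-≤-trans 0<half (≤-trans half≤yi (≤-trans yi≤load load≤0))))
    where
      yi≤load : y i ≤ load EH y w
      yi≤load = subst (_≤ load EH y w) (cong (λ b → if b then y i else 0ℚ) (cong₂ _∧_ i∈EH w∈i))
        (term≤∑ (λ j → if lookup EH j ∧ inc G w j then y j else 0ℚ) (λ j → if-nonNeg _ (y-nonNeg feas j)) i)
      load≤0 : load EH y w ≤ 0ℚ
      load≤0 = subst (load EH y w ≤_) (cong₂ _+_ (cong toℚ fw≡) (cong (λ b → if b then 0ℚ else _) w∈C))
        (load≤capacity feas w (covered-dropIsolated cov i w i∈EH w∈i))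

  Solve-degreeBounds : ∀ {ε VH EH C f out} → Solve G ε VH EH C f out → Covers VH EH → DegreeBounds C f out
  Solve-degreeBounds (done _) _ = degreeBounds-⊥
  Solve-degreeBounds (drop _ _ _ i _ _ s) cov = Solve-degreeBounds s (covers-step i cov)
  Solve-degreeBounds (pick {EH = EH} _ _ (feas , _) _ i u v i∈EH i-uv half≤yi fv≥1 _ s) cov =
    degreeBounds-∪⁅⁆ i-uv (Solve-fresh s i (lookup-─⁅⁆-self EH i)) fv≥1 f≥1-in-C (Solve-degreeBounds s (covers-step i cov))
    where
      f≥1-in-C : ∀ w → _ → (w ≡ u ⊎ w ≡ v) → 1 ℕ.≤ _
      f≥1-in-C w w∈C (inj₁ refl) = f≥1-at-heavy-edge feas cov i u (∈⇒lookup i∈EH) (inc-joinsˡ i-uv) w∈C half≤yi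
      f≥1-in-C w w∈C (inj₂ refl) = f≥1-at-heavy-edge feas cov i v (∈⇒lookup i∈EH) (inc-joinsʳ i-uv) w∈C half≤yi

  Solve-feasible : ∀ {ε C f out} → Solve G ε ⊤ ⊤ C f out → Feasible G f out
  Solve-feasible s i i∈out with DegreeBounds.bounded-end (Solve-degreeBounds s covers-⊤) i (∈⇒lookup i∈out)
  ... | w , w∈i , d≤f with inc⇒end {w} {i} w∈i
  ... | inj₁ refl = inj₁ d≤f
  ... | inj₂ refl = inj₂ d≤f

  -- The LP value is at most three times the output

  edgeSum : Subset m → (Fin m → ℚ) → ℚ
  edgeSum EH y = ∑ (λ i → if lookup EH i then y i else 0ℚ)

  vertexSum : Subset n → (Fin n → ℚ) → ℚ
  vertexSum VH z = ∑ (λ v → if lookup VH v then z v else 0ℚ)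

  load-mono-≤ : ∀ {EH EH′} {y y′ : Fin m → ℚ} w → (∀ j → lookup EH′ j ≡ true → lookup EH j ≡ true) →
    (∀ j → lookup EH′ j ≡ true → y′ j ≤ y j) → (∀ j → 0ℚ ≤ y j) → load EH′ y′ w ≤ load EH y w
  load-mono-≤ {EH} {EH′} {y} {y′} w EH′⊆EH y′≤y 0≤y = ∑-mono-≤ termwise
    where
      termwise : ∀ j → (if lookup EH′ j ∧ inc G w j then y′ j else 0ℚ) ≤ (if lookup EH j ∧ inc G w j then y j else 0ℚ)
      termwise j with lookup EH′ j in j∈EH′
      ... | false = if-nonNeg _ (0≤y j)
      ... | true rewrite EH′⊆EH j j∈EH′ with inc G w j
      ...   | true = y′≤y j j∈EH′
      ...   | false = ≤-refl

  module Restriction {ε VH EH C f} {y : Fin m → ℚ} {z : Fin n → ℚ}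
                     (feas : LP2.Feas G ε VH EH C f y z) (i : Fin m) (i∈EH : lookup EH i ≡ true) where
    EH′ : Subset m
    EH′ = EH ─ ⁅ i ⁆

    VH′ : Subset n
    VH′ = dropIsolated G VH EH′

    z′ : Fin n → ℚ
    z′ v = if lookup VH′ v then z v else 0ℚ

    EH′⊆EH : ∀ j → lookup EH′ j ≡ true → lookup EH j ≡ true
    EH′⊆EH = lookup-─-⊆ EH ⁅ i ⁆

    VH′⊆VH : ∀ v → lookup VH′ v ≡ true → lookup VH v ≡ true
    VH′⊆VH = dropIsolated-⊆ VH EH′

    z′-out : ∀ v → lookup VH′ v ≡ false → z′ v ≡ 0ℚ
    z′-out v v∉VH′ rewrite v∉VH′ = refl

    0≤z′ : ∀ v → 0ℚ ≤ z′ v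
    0≤z′ v = if-nonNeg _ (z-nonNeg feas v)

    z′≡z : ∀ v → lookup VH′ v ≡ true → z′ v ≡ z v
    z′≡z v v∈VH′ rewrite v∈VH′ = refl

    capacity-z′ : ∀ C′ f′ w → lookup VH′ w ≡ true → capacity C′ f′ z′ w ≡ capacity C′ f′ z w
    capacity-z′ C′ f′ w w∈VH′ = cong (λ t → toℚ (f′ w) + (if lookup C′ w then 0ℚ else t)) (z′≡z w w∈VH′)

    vertexSum-z′≤ : vertexSum VH′ z′ ≤ vertexSum VH z
    vertexSum-z′≤ = ∑-mono-≤ termwise
      where
        termwise : ∀ v → (if lookup VH′ v then z′ v else 0ℚ) ≤ (if lookup VH v then z v else 0ℚ)
        termwise v with lookup VH′ v in v∈VH′
        ... | false = if-nonNeg _ (z-nonNeg feas v)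
        ... | true rewrite VH′⊆VH v v∈VH′ = ≤-refl

    edgeSum-remove : edgeSum EH y ≡ edgeSum EH′ y + y i
    edgeSum-remove = ∑-remove (lookup EH) (lookup EH′) y i i∈EH (lookup-─⁅⁆-self EH i) (λ j → lookup-─⁅⁆-other EH)

    load-remove : ∀ w → inc G w i ≡ true → load EH y w ≡ load EH′ y w + y i
    load-remove w w∈i = ∑-remove (λ j → lookup EH j ∧ inc G w j) (λ j → lookup EH′ j ∧ inc G w j) y i
      (cong₂ _∧_ i∈EH w∈i) (cong (_∧ inc G w i) (lookup-─⁅⁆-self EH i))
      (λ j i≢j → cong (_∧ inc G w j) (lookup-─⁅⁆-other EH i≢j))

    y′ : Fin m → ℚ
    y′ j = if lookup EH′ j then y j else 0ℚ

    y′-feasible : LP2.Feas G ε VH′ EH′ C f y′ z′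
    y′-feasible = feas-intro y′-out z′-out (λ j → if-nonNeg _ (y-nonNeg feas j)) y′≤1 0≤z′ load≤cap
      where
        y′-out : ∀ j → lookup EH′ j ≡ false → y′ j ≡ 0ℚ
        y′-out j j∉EH′ rewrite j∉EH′ = refl
        y′≤1 : ∀ j → y′ j ≤ 1ℚ
        y′≤1 j with lookup EH′ j
        ... | true = y≤1 feas j
        ... | false = 0≤1
        load≤cap : ∀ w → lookup VH′ w ≡ true → load EH′ y′ w ≤ capacity C f z′ w
        load≤cap w w∈VH′ = subst (load EH′ y′ w ≤_) (sym (capacity-z′ C f w w∈VH′))
          (≤-trans (load-mono-≤ {EH} {EH′} w EH′⊆EH
                      (λ j j∈EH′ → ≤-reflexive (cong (λ b → if b then y j else 0ℚ) j∈EH′)) (y-nonNeg feas))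
                   (load≤capacity feas w (VH′⊆VH w w∈VH′)))

    objective≤y′-objective : 0ℚ ≤ 1ℚ + ε → y i ≡ 0ℚ →
      LP2.objective G ε VH EH C f y z ≤ LP2.objective G ε VH′ EH′ C f y′ z′
    objective≤y′-objective 0≤1+ε yi≡0 =
      subst (LP2.objective G ε VH EH C f y z ≤_)
        (trans (cong (LP2.objective G ε VH′ EH′ C f y′ z′ +_) (*-zeroʳ (toℚ 2))) (+-identityʳ _))
        (objective-step ε (edgeSum EH y) (edgeSum EH′ y′) (vertexSum VH z) (vertexSum VH′ z′) 0ℚ 0≤1+ε
          (≤-reflexive (trans edgeSum-remove (cong₂ _+_ (∑-cong restrict) yi≡0))) vertexSum-z′≤)
      where
        restrict : ∀ j → (if lookup EH′ j then y j else 0ℚ) ≡ (if lookup EH′ j then y′ j else 0ℚ)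
        restrict j with lookup EH′ j
        ... | true = refl
        ... | false = refl

    module Shrunk (u v : Fin n) (i-uv : Joins i u v) (half≤yi : half ≤ y i) (zv≡0 : z v ≡ 0ℚ)
                  (u∈VH : lookup VH u ≡ true) (v∈VH : lookup VH v ≡ true) where
      residual : Fin n → ℚ
      residual w = toℚ (f w ℕ.∸ 1) + (if lookup C w then 0ℚ else z w)

      0≤residual : ∀ w → 0ℚ ≤ residual w
      0≤residual w with lookup C w
      ... | true = +-nonNeg (0≤toℚ (f w ℕ.∸ 1)) ≤-refl
      ... | false = +-nonNeg (0≤toℚ (f w ℕ.∸ 1)) (z-nonNeg feas w)

      load′ : Fin n → ℚ
      load′ = load EH′ y

      load′≤residual+slack : ∀ w → inc G w i ≡ true → lookup VH w ≡ true → load′ w ≤ residual w + (1ℚ - y i)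
      load′≤residual+slack w w∈i w∈VH =
        ≤-by-gap ((F + Zw - (load′ w + y i)) + (1ℚ + F′ - F))
          (+-nonNeg (p≤q⇒0≤q-p (subst (_≤ F + Zw) (load-remove w w∈i) (load≤capacity feas w w∈VH)))
                    (p≤q⇒0≤q-p (subst (F ≤_) (toℚ-+ 1 (f w ℕ.∸ 1)) (toℚ-mono-≤ (ℕₚ.m≤n+m∸n (f w) 1)))))
          (solve 6 (λ F F′ Zw L yi one → F′ :+ Zw :+ (one :- yi) := L :+ ((F :+ Zw :- (L :+ yi)) :+ (one :+ F′ :- F)))
                 refl F F′ Zw (load′ w) (y i) 1ℚ)
        where
          F = toℚ (f w)
          F′ = toℚ (f w ℕ.∸ 1)
          Zw = if lookup C w then 0ℚ else z w

      0≤load′ : ∀ w → 0ℚ ≤ load′ w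
      0≤load′ w = ∑-nonNeg (λ j → if-nonNeg _ (y-nonNeg feas j))

      σu : ShrinkFactor (residual u) (load′ u)
      σu = shrinkFactor (residual u) (load′ u) (0≤residual u) (0≤load′ u)

      σv : ShrinkFactor (residual v) (load′ v)
      σv = shrinkFactor (residual v) (load′ v) (0≤residual v) (0≤load′ v)

      open ShrinkFactor σu using () renaming (factor to su; 0≤factor to 0≤su; factor≤1 to su≤1)
      open ShrinkFactor σv using () renaming (factor to sv; 0≤factor to 0≤sv; factor≤1 to sv≤1)

      scaleAt : Fin n → ℚ → Fin m → ℚ
      scaleAt w s j = if inc G w j then s else 1ℚ

      scale : Fin m → ℚ
      scale j = scaleAt u su j * scaleAt v sv j

      y″ : Fin m → ℚ
      y″ j = if lookup EH′ j then y j * scale j else 0ℚ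

      0≤scale : ∀ j → 0ℚ ≤ scale j
      0≤scale j = *-nonNeg (0≤if-then-1 (inc G u j) 0≤su) (0≤if-then-1 (inc G v j) 0≤sv)

      scale≤1 : ∀ j → scale j ≤ 1ℚ
      scale≤1 j = ≤-trans (*-≤ˡ (0≤if-then-1 (inc G u j) 0≤su) (if-then-1≤1 (inc G v j) sv≤1)) (if-then-1≤1 (inc G u j) su≤1)

      scale≤su : ∀ j → inc G u j ≡ true → scale j ≤ su
      scale≤su j u∈j = subst (λ b → scale j ≤ (if b then su else 1ℚ)) u∈j
        (*-≤ˡ (0≤if-then-1 (inc G u j) 0≤su) (if-then-1≤1 (inc G v j) sv≤1))

      scale≤sv : ∀ j → inc G v j ≡ true → scale j ≤ sv
      scale≤sv j v∈j = subst (λ b → scale j ≤ (if b then sv else 1ℚ)) v∈j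
        (*-≤ʳ (0≤if-then-1 (inc G v j) 0≤sv) (if-then-1≤1 (inc G u j) su≤1))

      y*scale≤y : ∀ j → y j * scale j ≤ y j
      y*scale≤y j = *-≤ˡ (y-nonNeg feas j) (scale≤1 j)

      load-y″≤ : ∀ w s → (∀ j → inc G w j ≡ true → scale j ≤ s) → load EH′ y″ w ≤ s * load′ w
      load-y″≤ w s scale≤s = subst (load EH′ y″ w ≤_) (sym (*-distribˡ-∑ s (λ j → if lookup EH′ j ∧ inc G w j then y j else 0ℚ)))
        (∑-mono-≤ (λ j → if-restricted-*-≤ (lookup EH′ j) (inc G w j) (y-nonNeg feas j) (scale≤s j)))

      C″ : Subset n
      C″ = C ∪ ⁅ v ⁆

      f″ : Fin n → ℕ
      f″ = decr G u v f

      capacity″-u : lookup VH′ u ≡ true → capacity C″ f″ z′ u ≡ residual u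
      capacity″-u u∈VH′ = begin
        capacity C″ f″ z′ u  ≡⟨ capacity-z′ C″ f″ u u∈VH′ ⟩
        toℚ (f″ u) + (if lookup C″ u then 0ℚ else z u)
          ≡⟨ cong₂ (λ k b → toℚ k + (if b then 0ℚ else z u)) (decr-joinedˡ u v f) u∈C″⇔u∈C ⟩
        residual u  ∎
        where
          open ≡-Reasoning
          u∈C″⇔u∈C : lookup C″ u ≡ lookup C u
          u∈C″⇔u∈C = trans (lookup-∪⁅⁆ C v u) (trans (cong (lookup C u ∨_) (≟-≢ (λ v≡u → joins-≢ i-uv (sym v≡u)))) (𝔹.∨-identityʳ _))

      capacity″-v : capacity C″ f″ z′ v ≡ residual v
      capacity″-v = cong₂ _+_ (cong toℚ (decr-joinedʳ u v f)) (trans v∈C″ (sym (no-slack (lookup C v))))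
        where
          v∈C″ : (if lookup C″ v then 0ℚ else z′ v) ≡ 0ℚ
          v∈C″ rewrite lookup-∪⁅⁆ C v v | ≟-refl v | 𝔹.∨-zeroʳ (lookup C v) = refl
          no-slack : ∀ b → (if b then 0ℚ else z v) ≡ 0ℚ
          no-slack true = refl
          no-slack false = zv≡0

      capacity″-other : ∀ w → ¬ w ≡ u → ¬ w ≡ v → lookup VH′ w ≡ true → capacity C″ f″ z′ w ≡ capacity C f z w
      capacity″-other w w≢u w≢v w∈VH′ = trans (capacity-z′ C″ f″ w w∈VH′)
        (cong₂ (λ k b → toℚ k + (if b then 0ℚ else z w)) (decr-other f w≢u w≢v) w∈C″⇔w∈C)
        where
          w∈C″⇔w∈C : lookup C″ w ≡ lookup C w
          w∈C″⇔w∈C = trans (lookup-∪⁅⁆ C v w) (trans (cong (lookup C w ∨_) (≟-≢ (λ v≡w → w≢v (sym v≡w)))) (𝔹.∨-identityʳ _))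

      y″-feasible : LP2.Feas G ε VH′ EH′ C″ f″ y″ z′
      y″-feasible = feas-intro y″-out z′-out 0≤y″ y″≤1 0≤z′ (λ w w∈VH′ → load≤cap w w∈VH′ (w ≟ u) (w ≟ v))
        where
          y″-out : ∀ j → lookup EH′ j ≡ false → y″ j ≡ 0ℚ
          y″-out j j∉EH′ = cong (λ b → if b then y j * scale j else 0ℚ) j∉EH′
          0≤y″ : ∀ j → 0ℚ ≤ y″ j
          0≤y″ j = if-nonNeg (lookup EH′ j) (*-nonNeg (y-nonNeg feas j) (0≤scale j))
          y″≤1 : ∀ j → y″ j ≤ 1ℚ
          y″≤1 j = if-≤ (lookup EH′ j) (≤-trans (y*scale≤y j) (y≤1 feas j)) 0≤1
          y″≤y : ∀ j → lookup EH′ j ≡ true → y″ j ≤ y j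
          y″≤y j j∈EH′ = subst (λ b → (if b then y j * scale j else 0ℚ) ≤ y j) (sym j∈EH′) (y*scale≤y j)
          load≤cap : ∀ w → lookup VH′ w ≡ true → Dec (w ≡ u) → Dec (w ≡ v) → load EH′ y″ w ≤ capacity C″ f″ z′ w
          load≤cap w w∈VH′ (yes refl) _ = subst (load EH′ y″ w ≤_) (sym (capacity″-u w∈VH′))
            (≤-trans (load-y″≤ u su scale≤su) (ShrinkFactor.factor*R≤T σu))
          load≤cap w w∈VH′ (no _) (yes refl) = subst (load EH′ y″ w ≤_) (sym capacity″-v)
            (≤-trans (load-y″≤ v sv scale≤sv) (ShrinkFactor.factor*R≤T σv))
          load≤cap w w∈VH′ (no w≢u) (no w≢v) = subst (load EH′ y″ w ≤_) (sym (capacity″-other w w≢u w≢v w∈VH′))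
            (≤-trans (load-mono-≤ {EH} {EH′} w EH′⊆EH y″≤y (y-nonNeg feas)) (load≤capacity feas w (VH′⊆VH w w∈VH′)))

      edgeSum-y≤ : edgeSum EH y ≤ edgeSum EH′ y″ + (y i + (1ℚ - su) * load′ u + (1ℚ - sv) * load′ v)
      edgeSum-y≤ = begin
        edgeSum EH y                                   ≡⟨ edgeSum-remove ⟩
        edgeSum EH′ y + y i
          ≤⟨ +-monoˡ-≤ (y i) (∑-mono-≤ (λ j →
               restricted-shrink-loss (lookup EH′ j) (inc G u j) (inc G v j) (y-nonNeg feas j) su≤1 sv≤1)) ⟩
        ∑ (λ j → Y″ j + (1ℚ - su) * U j + (1ℚ - sv) * V j) + y i  ≡⟨ cong (_+ y i) sum-split ⟩
        edgeSum EH′ y″ + (1ℚ - su) * load′ u + (1ℚ - sv) * load′ v + y i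
          ≡⟨ solve 4 (λ S a b c → S :+ a :+ b :+ c := S :+ (c :+ a :+ b))
                     refl (edgeSum EH′ y″) ((1ℚ - su) * load′ u) ((1ℚ - sv) * load′ v) (y i) ⟩
        edgeSum EH′ y″ + (y i + (1ℚ - su) * load′ u + (1ℚ - sv) * load′ v)  ∎
        where
          open ≤-Reasoning
          Y″ U V : Fin m → ℚ
          Y″ j = if lookup EH′ j then y″ j else 0ℚ
          U j = if lookup EH′ j ∧ inc G u j then y j else 0ℚ
          V j = if lookup EH′ j ∧ inc G v j then y j else 0ℚ
          sum-split : ∑ (λ j → Y″ j + (1ℚ - su) * U j + (1ℚ - sv) * V j)
                    ≡ edgeSum EH′ y″ + (1ℚ - su) * load′ u + (1ℚ - sv) * load′ v
          sum-split = begin-equality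
            ∑ (λ j → Y″ j + (1ℚ - su) * U j + (1ℚ - sv) * V j)
              ≡⟨ ∑-distrib-+ (λ j → Y″ j + (1ℚ - su) * U j) (λ j → (1ℚ - sv) * V j) ⟩
            ∑ (λ j → Y″ j + (1ℚ - su) * U j) + ∑ (λ j → (1ℚ - sv) * V j)
              ≡⟨ cong₂ _+_ (∑-distrib-+ Y″ (λ j → (1ℚ - su) * U j)) (sym (*-distribˡ-∑ (1ℚ - sv) V)) ⟩
            edgeSum EH′ y″ + ∑ (λ j → (1ℚ - su) * U j) + (1ℚ - sv) * load′ v
              ≡⟨ cong (λ t → edgeSum EH′ y″ + t + (1ℚ - sv) * load′ v) (sym (*-distribˡ-∑ (1ℚ - su) U)) ⟩
            edgeSum EH′ y″ + (1ℚ - su) * load′ u + (1ℚ - sv) * load′ v  ∎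


      objective≤y″-objective+3 : 0ℚ ≤ 1ℚ + ε →
        LP2.objective G ε VH EH C f y z ≤ LP2.objective G ε VH′ EH′ C″ f″ y″ z′ + toℚ 3
      objective≤y″-objective+3 0≤1+ε = ≤-trans
        (objective-step ε (edgeSum EH y) (edgeSum EH′ y″) (vertexSum VH z) (vertexSum VH′ z′) _ 0≤1+ε edgeSum-y≤ vertexSum-z′≤)
        (+-monoʳ-≤ (LP2.objective G ε VH′ EH′ C″ f″ y″ z′)
          (heavy-edge-loss (y i) _ _ half≤yi (loss σu u∈VH (inc-joinsˡ i-uv)) (loss σv v∈VH (inc-joinsʳ i-uv))))
        where
          loss : ∀ {w} (σ : ShrinkFactor (residual w) (load′ w)) → lookup VH w ≡ true → inc G w i ≡ true →
                 (1ℚ - ShrinkFactor.factor σ) * load′ w ≤ 1ℚ - y i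
          loss {w} σ w∈VH w∈i = ShrinkFactor.loss≤ σ (1ℚ - y i) (p≤q⇒0≤q-p (y≤1 feas i)) (load′≤residual+slack w w∈i w∈VH)

  objective≤0-without-edges : ∀ {ε VH EH C f y z} → 0ℚ ≤ 1ℚ + ε → (∀ i → i ∉ EH) →
    LP2.Feas G ε VH EH C f y z → LP2.objective G ε VH EH C f y z ≤ 0ℚ
  objective≤0-without-edges {ε} {VH} {EH} {C} {f} {y} {z} 0≤1+ε no-edges feas = subst (LP2.objective G ε VH EH C f y z ≤_)
    (solve 1 (λ e → con (toℚ 2) :* con 0ℚ :- (con 1ℚ :+ e) :* con 0ℚ :+ con (toℚ 2) :* con 0ℚ := con 0ℚ) refl ε)
    (objective-step ε (edgeSum EH y) 0ℚ (vertexSum VH z) 0ℚ 0ℚ 0≤1+ε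
      (≤-reflexive (trans edgeSum≡0 (sym (+-identityʳ 0ℚ)))) (∑-nonNeg (λ v → if-nonNeg _ (z-nonNeg feas v))))
    where
      edgeSum≡0 : edgeSum EH y ≡ 0ℚ
      edgeSum≡0 = trans (∑-cong (λ j → cong (λ b → if b then y j else 0ℚ) (∉⇒lookup (no-edges j)))) (∑-zero m)

  Solve-objective≤ : ∀ {ε VH EH C f out} → 0ℚ ≤ 1ℚ + ε → Solve G ε VH EH C f out → Covers VH EH →
    ∀ y z → LP2.Feas G ε (dropIsolated G VH EH) EH C f y z →
    LP2.objective G ε (dropIsolated G VH EH) EH C f y z ≤ toℚ 3 * toℚ ∣ out ∣
  Solve-objective≤ {ε} {VH} {EH} {C} {f} 0≤1+ε (done no-edges) _ y z feas =
    subst (LP2.objective G ε (dropIsolated G VH EH) EH C f y z ≤_)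
      (sym (trans (cong (λ k → toℚ 3 * toℚ k) (∣⊥∣≡0 m)) (*-zeroʳ (toℚ 3))))
      (objective≤0-without-edges 0≤1+ε no-edges feas)
  Solve-objective≤ 0≤1+ε (drop {EH = EH} _ _ (feas , _ , optimal) i i∈EH yi≡0 s) cov y₀ z₀ feas₀ =
    ≤-trans (optimal y₀ z₀ feas₀)
      (≤-trans (objective≤y′-objective 0≤1+ε yi≡0) (Solve-objective≤ 0≤1+ε s (covers-step i cov) y′ z′ y′-feasible))
    where open Restriction feas i (∈⇒lookup i∈EH)
  Solve-objective≤ 0≤1+ε (pick {EH = EH} {out = out} _ _ (feas , _ , optimal) _ i u v i∈EH i-uv half≤yi _ zv≡0 s) cov y₀ z₀ feas₀ =
    ≤-trans (optimal y₀ z₀ feas₀)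
      (≤-trans (objective≤y″-objective+3 0≤1+ε)
        (≤-trans (+-monoˡ-≤ (toℚ 3) (Solve-objective≤ 0≤1+ε s (covers-step i cov) y″ z′ y″-feasible))
          (≤-reflexive (trans (*-toℚ-suc (toℚ 3) ∣ out ∣)
            (cong (λ k → toℚ 3 * toℚ k) (sym (∣p∪⁅i⁆∣ out i (Solve-fresh s i (lookup-─⁅⁆-self EH i)))))))))
    where
      open Restriction feas i (∈⇒lookup i∈EH)
      open Shrunk u v i-uv half≤yi zv≡0 (covered-dropIsolated cov i u (∈⇒lookup i∈EH) (inc-joinsˡ i-uv))
                                        (covered-dropIsolated cov i v (∈⇒lookup i∈EH) (inc-joinsʳ i-uv))

  -- A feasible solution yields an LP solution of large value

  module _ (c : Fin n → ℕ) (F : Subset m) (F-feasible : Feasible G c F) where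
    overloaded : Fin n → Bool
    overloaded v = ⌊ c v ℕ.<? deg G F v ⌋

    excess≤overloaded-count : ∀ v → deg G F v ℕ.∸ c v ℕ.≤ count (λ j → (lookup F j ∧ inc G v j) ∧ overloaded v)
    excess≤overloaded-count v with c v ℕ.<? deg G F v
    ... | yes _ = ℕₚ.≤-trans (ℕₚ.m∸n≤m (deg G F v) (c v))
                    (ℕₚ.≤-reflexive (count-cong (λ j → sym (𝔹.∧-identityʳ (lookup F j ∧ inc G v j)))))
    ... | no c≮deg = ℕₚ.≤-trans (ℕₚ.≤-reflexive (ℕₚ.m≤n⇒m∸n≡0 (ℕₚ.≮⇒≥ c≮deg))) z≤n

    not-overloaded : ∀ v → deg G F v ℕ.≤ c v → overloaded v ≡ false
    not-overloaded v deg≤c with c v ℕ.<? deg G F v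
    ... | yes c<deg = ⊥-elim (ℕₚ.<⇒≱ c<deg deg≤c)
    ... | no _ = refl

    overloaded-ends≤1 : ∀ j → lookup F j ≡ true → count (λ v → inc G v j ∧ overloaded v) ℕ.≤ 1
    overloaded-ends≤1 j j∈F = ℕₚ.≤-trans (count-∨-≤ (λ v → ⌊ v ≟ a ⌋) (λ v → ⌊ v ≟ b ⌋) overloaded)
      (subst₂ (λ x y → x ℕ.+ y ℕ.≤ 1) (sym (count-≟-∧ a overloaded)) (sym (count-≟-∧ b overloaded))
        (one-end-fine (F-feasible j (lookup⇒∈ j∈F))))
      where
        a = proj₁ (Graph.ends G j)
        b = proj₂ (Graph.ends G j)
        indicator≤1 : ∀ x → (if x then 1 else 0) ℕ.≤ 1
        indicator≤1 true = ℕₚ.≤-refl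
        indicator≤1 false = z≤n
        one-end-fine : (deg G F a ℕ.≤ c a) ⊎ (deg G F b ℕ.≤ c b) →
                       (if overloaded a then 1 else 0) ℕ.+ (if overloaded b then 1 else 0) ℕ.≤ 1
        one-end-fine (inj₁ deg≤c) rewrite not-overloaded a deg≤c = indicator≤1 _
        one-end-fine (inj₂ deg≤c) rewrite not-overloaded b deg≤c = subst (ℕ._≤ 1) (sym (ℕₚ.+-identityʳ _)) (indicator≤1 _)

    total-excess≤∣F∣ : ∑ (λ v → toℚ (deg G F v ℕ.∸ c v)) ≤ toℚ ∣ F ∣
    total-excess≤∣F∣ = begin
      ∑ (λ v → toℚ (deg G F v ℕ.∸ c v))
        ≤⟨ ∑-mono-≤ (λ v → subst (toℚ (deg G F v ℕ.∸ c v) ≤_) (toℚ-count (λ j → (lookup F j ∧ inc G v j) ∧ overloaded v))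
                                (toℚ-mono-≤ (excess≤overloaded-count v))) ⟩
      ∑ (λ v → ∑ (λ j → incidence v j))
        ≡⟨ ∑-comm incidence ⟩
      ∑ (λ j → ∑ (λ v → incidence v j))
        ≤⟨ ∑-mono-≤ per-edge ⟩
      ∑ (λ j → if lookup F j then 1ℚ else 0ℚ)
        ≡⟨ sym (toℚ-count (lookup F)) ⟩
      toℚ (count (lookup F))
        ≡⟨ cong toℚ (sym (∣p∣≡count F)) ⟩
      toℚ ∣ F ∣  ∎
      where
        open ≤-Reasoning
        incidence : Fin n → Fin m → ℚ
        incidence v j = if (lookup F j ∧ inc G v j) ∧ overloaded v then 1ℚ else 0ℚ
        per-edge : ∀ j → ∑ (λ v → incidence v j) ≤ (if lookup F j then 1ℚ else 0ℚ)
        per-edge j with lookup F j in j∈F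
        ... | true = subst (_≤ 1ℚ) (toℚ-count (λ v → inc G v j ∧ overloaded v)) (toℚ-mono-≤ (overloaded-ends≤1 j j∈F))
        ... | false = ≤-reflexive (∑-zero n)

    module IndicatorSolution (ε : ℚ) where
      VH₀ : Subset n
      VH₀ = dropIsolated G ⊤ ⊤

      y₀ : Fin m → ℚ
      y₀ j = if lookup F j then 1ℚ else 0ℚ

      z₀ : Fin n → ℚ
      z₀ v = if lookup VH₀ v then toℚ (deg G F v ℕ.∸ c v) else 0ℚ

      load-y₀ : ∀ w → load ⊤ y₀ w ≡ toℚ (deg G F w)
      load-y₀ w = trans (∑-cong termwise) (sym (toℚ-count (λ j → lookup F j ∧ inc G w j)))
        where
          termwise : ∀ j → (if lookup ⊤ j ∧ inc G w j then y₀ j else 0ℚ) ≡ (if lookup F j ∧ inc G w j then 1ℚ else 0ℚ)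
          termwise j rewrite lookup-⊤ j with inc G w j
          ... | true = sym (cong (λ b → if b then 1ℚ else 0ℚ) (𝔹.∧-identityʳ (lookup F j)))
          ... | false = cong (λ b → if b then 1ℚ else 0ℚ) (sym (𝔹.∧-zeroʳ (lookup F j)))

      y₀z₀-feasible : LP2.Feas G ε VH₀ ⊤ ⊥ c y₀ z₀
      y₀z₀-feasible = feas-intro y₀-out z₀-out (λ j → if-nonNeg (lookup F j) 0≤1) (λ j → if-≤ (lookup F j) ≤-refl 0≤1)
                        (λ v → if-nonNeg (lookup VH₀ v) (0≤toℚ (deg G F v ℕ.∸ c v))) load≤cap
        where
          y₀-out : ∀ j → lookup ⊤ j ≡ false → y₀ j ≡ 0ℚ
          y₀-out j j∉⊤ = ⊥-elim (𝔹.not-¬ refl (trans (sym j∉⊤) (lookup-⊤ j)))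
          z₀-out : ∀ v → lookup VH₀ v ≡ false → z₀ v ≡ 0ℚ
          z₀-out v v∉VH₀ = cong (λ b → if b then toℚ (deg G F v ℕ.∸ c v) else 0ℚ) v∉VH₀
          load≤cap : ∀ w → lookup VH₀ w ≡ true → load ⊤ y₀ w ≤ capacity ⊥ c z₀ w
          load≤cap w w∈VH₀ = subst₂ _≤_ (sym (load-y₀ w)) (sym capacity≡)
            (subst (toℚ (deg G F w) ≤_) (toℚ-+ (c w) (deg G F w ℕ.∸ c w)) (toℚ-mono-≤ (ℕₚ.m≤n+m∸n (deg G F w) (c w))))
            where
              capacity≡ : capacity ⊥ c z₀ w ≡ toℚ (c w) + toℚ (deg G F w ℕ.∸ c w)
              capacity≡ = cong₂ (λ b b′ → toℚ (c w) + (if b then 0ℚ else (if b′ then toℚ (deg G F w ℕ.∸ c w) else 0ℚ)))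
                                (lookup-⊥ w) w∈VH₀

      edgeSum-y₀ : edgeSum ⊤ y₀ ≡ toℚ ∣ F ∣
      edgeSum-y₀ = trans (∑-cong (λ j → cong (λ b → if b then y₀ j else 0ℚ) (lookup-⊤ j)))
                         (trans (sym (toℚ-count (lookup F))) (cong toℚ (sym (∣p∣≡count F))))

      vertexSum-z₀≤ : vertexSum VH₀ z₀ ≤ toℚ ∣ F ∣
      vertexSum-z₀≤ = ≤-trans (∑-mono-≤ (λ v → if-≤ (lookup VH₀ v) (z₀≤excess v) (0≤toℚ (deg G F v ℕ.∸ c v))))
                              total-excess≤∣F∣
        where
          z₀≤excess : ∀ v → z₀ v ≤ toℚ (deg G F v ℕ.∸ c v)
          z₀≤excess v = if-≤ (lookup VH₀ v) ≤-refl (0≤toℚ (deg G F v ℕ.∸ c v))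

theorem3 : ∀ {n m : ℕ} (G : Graph n m) → Connected G →
    (c : Fin n → ℕ) (ε : ℚ) → 0ℚ < ε → ε < 1ℚ →
    (out : Subset m) → Solve G ε ⊤ ⊤ ⊥ c out →
    Feasible G c out ×
    (∀ (F : Subset m) → Feasible G c F →
      ((1ℚ - ε) * (1ℚ - ε)) * toℚ ∣ F ∣ ≤ toℚ 3 * toℚ ∣ out ∣)
theorem3 G _ c ε 0<ε ε<1 out solve = Solve-feasible G solve , approximation
  where
    approximation : ∀ F → Feasible G c F → (1ℚ - ε) * (1ℚ - ε) * toℚ ∣ F ∣ ≤ toℚ 3 * toℚ ∣ out ∣
    approximation F F-feasible =
      approximation-arithmetic ε (toℚ ∣ F ∣) (vertexSum G VH₀ z₀) (toℚ 3 * toℚ ∣ out ∣)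
        (<⇒≤ 0<ε) (<⇒≤ ε<1) (0≤toℚ ∣ F ∣) vertexSum-z₀≤
        (subst (λ t → toℚ 2 * t - (1ℚ + ε) * vertexSum G VH₀ z₀ ≤ toℚ 3 * toℚ ∣ out ∣) edgeSum-y₀
          (Solve-objective≤ G (+-nonNeg 0≤1 (<⇒≤ 0<ε)) solve (covers-⊤ G) y₀ z₀ y₀z₀-feasible))
      where open IndicatorSolution G c F F-feasible ε
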